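{- Let $n\ge 1$ be an integer and let $\mathcal P_{n-1}$ be the space of complex polynomials of degree at most $n-1$. Then, as linear operators on $\mathcal P_{n-1}$, $$\tilde F_n\,\tilde U_n^{ -1}=\tilde V_n^{ -1}\,\tilde C_n\,\tilde V_n .$$
   Context: The Euler polynomials $A_k(x)$ are defined by $\frac{A_k(x)}{(1-x)^{k+1}}=\sum_{m\ge0}m^kx^m$ (so $A_0=1$, $A_1=x$, $A_2=x+x^2,\dots$), and for $k\ge1$ we put $\tilde A_k(x)=A_k(x)/x$. All operators below are linear operators on $\mathcal P_{n-1}$ given by their values on the monomials $x^p$, $p=0,1,\dots,n-1$: $\tilde U_n x^p=\frac{1}{n!}(1-x)^{n-1-p}\tilde A_{p+1}(x)$ (this operator is invertible; explicitly $\tilde U_n^{ -1}x^p=(x-1)_p[x+1]_{n-p-1}$, where $(\varphi)_k=\varphi(\varphi-1)\cdots(\varphi-k+1)$ and $[\varphi]_k=\varphi(\varphi+1)\cdots(\varphi+k-1)$, both equal to $1$ for $k=0$); $\tilde F_n x^p=(1-x)^{2n+1}\sum_{m\ge1}m^{p+1}\binom{m+n}{n}x^{m-1}$ (a polynomial of degree $\le n-1$); $\tilde V_n x^p=(1+x)^{n-p-1}x^p$ (so $\tilde V_n^{ -1}x^p=(1-x)^{n-p-1}x^p$); $\tilde C_n x^p=\frac{(n+p+1)!}{(p+1)!}x^p$. -}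

module Defs where

open import Data.Bool using (if_then_else_)
open import Data.Nat as ℕ using (ℕ; zero; suc; _∸_; _!; _≡ᵇ_)
open import Data.Nat.DivMod using (_/_)
open import Data.Nat.Properties using (_!≢0)
open import Data.Nat.Combinatorics using (_C_)
open import Data.Integer using (ℤ; +_; _+_; _*_; _-_)

-- A (formal) polynomial / power series with integer coefficients,
-- given by its coefficient function: f k = coefficient of x^k.
Poly : Set
Poly = ℕ → ℤ

Σ< : ℕ → (ℕ → ℤ) → ℤ
Σ< zero    f = + 0
Σ< (suc n) f = Σ< n f + f n

const : ℤ → Poly
const c zero    = c
const c (suc _) = + 0

mono : ℕ → Poly
mono p k = if k ≡ᵇ p then + 1 else + 0

X : Poly
X = mono 1

infixl 6 _⊕_ _⊖_
infixl 7 _⊗_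

_⊕_ : Poly → Poly → Poly
(f ⊕ g) k = f k + g k

_⊖_ : Poly → Poly → Poly
(f ⊖ g) k = f k - g k

_⊗_ : Poly → Poly → Poly
(f ⊗ g) k = Σ< (suc k) (λ j → f j * g (k ∸ j))

scale : ℤ → Poly → Poly
scale c f k = c * f k

pow : Poly → ℕ → Poly
pow f zero    = const (+ 1)
pow f (suc e) = pow f e ⊗ f

prod : ℕ → (ℕ → Poly) → Poly
prod zero    φ = const (+ 1)
prod (suc k) φ = prod k φ ⊗ φ k

falling : Poly → ℕ → Poly
falling φ k = prod k (λ i → φ ⊖ const (+ i))

rising : Poly → ℕ → Poly
rising φ k = prod k (λ i → φ ⊕ const (+ i))

-- A linear operator on P_{n-1} is given by its values T p on the monomials x^p, p < n.
Op : Set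
Op = ℕ → Poly

apply : ℕ → Op → Poly → Poly
apply n T f k = Σ< n (λ p → f p * T p k)

compose : ℕ → Op → Op → Op
compose n S T p = apply n S (T p)

Ut-inv : ℕ → Op
Ut-inv n p = falling (X ⊖ const (+ 1)) p ⊗ rising (X ⊕ const (+ 1)) (n ∸ p ∸ 1)

-- F̃_n x^p = (1-x)^{2n+1} Σ_{m≥1} m^{p+1} C(m+n,n) x^{m-1}
-- (the series has coefficient of x^i equal to (i+1)^{p+1} C(i+1+n, n))
Ft : ℕ → Op
Ft n p = pow (const (+ 1) ⊖ X) (suc (2 ℕ.* n))
       ⊗ (λ i → + (suc i ℕ.^ suc p ℕ.* ((suc i ℕ.+ n) C n)))

Vt : ℕ → Op
Vt n p = pow (const (+ 1) ⊕ X) (n ∸ p ∸ 1) ⊗ mono p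

Vt-inv : ℕ → Op
Vt-inv n p = pow (const (+ 1) ⊖ X) (n ∸ p ∸ 1) ⊗ mono p

Ct : ℕ → Op
Ct n p = scale (+ (_/_ ((n ℕ.+ p ℕ.+ 1) !) ((p ℕ.+ 1) !) {{(p ℕ.+ 1) !≢0}})) (mono p)

module Submission where

-- Multiplying a sequence by (1-x) is the backward difference Δf(k) = f(k) - f(k-1),
-- so (1-x)ᵉ acts as Δᵉ.  Write n = r + p + 1 and N = 2n+1.
--  * Left side.  F̃ₙ xᵠ = Δᴺ of the series i ↦ (i+1)^{q+1} C(i+1+n, n).  Summing against the
--    coefficients of Ũₙ⁻¹ xᵖ = (x-1)ₚ [x+1]ᵣ amounts to evaluating that polynomial at x = m := i+1,
--    which gives (m-1)ₚ·(m+r)ᵣ·m, i.e. the sequence  Φ(i) = n!·C(m+r, n)·C(m+n, n).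
--  * Right side.  Ṽₙ⁻¹ xᵠ = Δ^{n-q-1} xᵠ and xᵠ = Δ^{n+q+2} of a shifted binomial sequence, so the
--    right side is Δᴺ of a linear combination of binomial sequences; by the Chu–Vandermonde
--    identity that combination is again Φ.

open import Defs
open import Data.Nat as ℕ using (ℕ; zero; suc; _∸_; _!; _≤_; _<_; _≤?_)
import Data.Nat.Properties as ℕP
open import Data.Nat.Properties using (_!≢0)
open import Data.Nat.DivMod using (_/_; m*n/n≡m)
open import Data.Nat.Combinatorics using (_C_; nCk+nC[k+1]≡[n+1]C[k+1]; nCn≡1; k>n⇒nCk≡0)
import Data.Nat.Tactic.RingSolver as ℕ-Solver
open import Data.Integer using (ℤ; +_; _+_; _*_; _-_; -[1+_]; _^_)
import Data.Integer.Properties as ℤP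
import Data.Integer.Tactic.RingSolver as ℤ-Solver
open import Data.Empty using (⊥-elim)
open import Data.Product using (_×_; _,_; proj₁; proj₂)
open import Relation.Nullary using (yes; no)
open import Relation.Binary.PropositionalEquality
open ≡-Reasoning

-- Finite sums  Σ< n f = f 0 + ... + f (n-1)  over ℤ

Σ-cong : ∀ n {f g : ℕ → ℤ} → (∀ i → i < n → f i ≡ g i) → Σ< n f ≡ Σ< n g
Σ-cong zero    h = refl
Σ-cong (suc n) h = cong₂ _+_ (Σ-cong n (λ i i<n → h i (ℕP.m<n⇒m<1+n i<n))) (h n (ℕP.n<1+n n))

Σ-cong′ : ∀ n {f g : ℕ → ℤ} → (∀ i → f i ≡ g i) → Σ< n f ≡ Σ< n g
Σ-cong′ n h = Σ-cong n (λ i _ → h i)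

Σ-zero : ∀ n (f : ℕ → ℤ) → (∀ i → i < n → f i ≡ + 0) → Σ< n f ≡ + 0
Σ-zero zero    f h = refl
Σ-zero (suc n) f h
  rewrite Σ-zero n f (λ i i<n → h i (ℕP.m<n⇒m<1+n i<n)) | h n (ℕP.n<1+n n) = refl

Σ-+ : ∀ n (f g : ℕ → ℤ) → Σ< n (λ i → f i + g i) ≡ Σ< n f + Σ< n g
Σ-+ zero    f g = refl
Σ-+ (suc n) f g rewrite Σ-+ n f g = interchange (Σ< n f) (Σ< n g) (f n) (g n)
  where
  interchange : ∀ (a b c d : ℤ) → (a + b) + (c + d) ≡ (a + c) + (b + d)
  interchange = ℤ-Solver.solve-∀

Σ-- : ∀ n (f g : ℕ → ℤ) → Σ< n (λ i → f i - g i) ≡ Σ< n f - Σ< n g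
Σ-- zero    f g = refl
Σ-- (suc n) f g rewrite Σ-- n f g = interchange (Σ< n f) (Σ< n g) (f n) (g n)
  where
  interchange : ∀ (a b c d : ℤ) → (a - b) + (c - d) ≡ (a + c) - (b + d)
  interchange = ℤ-Solver.solve-∀

Σ-*ˡ : ∀ n (c : ℤ) (f : ℕ → ℤ) → Σ< n (λ i → c * f i) ≡ c * Σ< n f
Σ-*ˡ zero    c f = sym (ℤP.*-zeroʳ c)
Σ-*ˡ (suc n) c f rewrite Σ-*ˡ n c f = sym (ℤP.*-distribˡ-+ c (Σ< n f) (f n))

Σ-*ʳ : ∀ n (c : ℤ) (f : ℕ → ℤ) → Σ< n (λ i → f i * c) ≡ Σ< n f * c
Σ-*ʳ zero    c f = refl
Σ-*ʳ (suc n) c f rewrite Σ-*ʳ n c f = sym (ℤP.*-distribʳ-+ c (Σ< n f) (f n))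

Σ-shift : ∀ n (f : ℕ → ℤ) → Σ< (suc n) f ≡ f 0 + Σ< n (λ i → f (suc i))
Σ-shift zero    f = trans (ℤP.+-identityˡ (f 0)) (sym (ℤP.+-identityʳ (f 0)))
Σ-shift (suc n) f rewrite Σ-shift n f = ℤP.+-assoc (f 0) _ _

Σ-split : ∀ a b (f : ℕ → ℤ) → Σ< (a ℕ.+ b) f ≡ Σ< a f + Σ< b (λ j → f (a ℕ.+ j))
Σ-split a zero    f rewrite ℕP.+-identityʳ a = sym (ℤP.+-identityʳ _)
Σ-split a (suc b) f rewrite ℕP.+-suc a b | Σ-split a b f = ℤP.+-assoc (Σ< a f) _ _

Σ-single : ∀ n t (h : ℕ → ℤ) → t < n → (∀ s → s < n → s ≢ t → h s ≡ + 0) → Σ< n h ≡ h t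
Σ-single (suc n) t h t<n z with t ℕP.≟ n
... | yes refl = trans (cong (_+ h t) (Σ-zero n h (λ s s<n → z s (ℕP.m<n⇒m<1+n s<n) (λ e → ℕP.<-irrefl e s<n))))
                       (ℤP.+-identityˡ _)
... | no t≢n = trans (cong₂ _+_ (Σ-single n t h (ℕP.≤∧≢⇒< (ℕP.≤-pred t<n) t≢n) (λ s s<n → z s (ℕP.m<n⇒m<1+n s<n)))
                                (z n (ℕP.n<1+n n) (λ e → t≢n (sym e))))
                     (ℤP.+-identityʳ _)

Σ-reverse : ∀ k (f : ℕ → ℤ) → Σ< (suc k) f ≡ Σ< (suc k) (λ j → f (k ∸ j))
Σ-reverse zero    f = refl
Σ-reverse (suc k) f rewrite Σ-reverse k f | Σ-shift (suc k) (λ j → f (suc k ∸ j)) =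
  ℤP.+-comm (Σ< (suc k) (λ j → f (k ∸ j))) (f (suc k))

-- Cauchy products with linear polynomials
--
-- Associativity of ⊗ is only needed when the last factor is linear (degree ≤ 1), and in that
-- case a product is an explicit combination of f and its shift x·f.

shift : Poly → Poly
shift f zero    = + 0
shift f (suc k) = f k

IsLinear : Poly → Set
IsLinear L = ∀ i → L (suc (suc i)) ≡ + 0

⊗-comm : ∀ (f g : Poly) k → (f ⊗ g) k ≡ (g ⊗ f) k
⊗-comm f g k = trans (Σ-reverse k _) (Σ-cong (suc k) λ j j≤k →
  trans (cong (f (k ∸ j) *_) (cong g (ℕP.m∸[m∸n]≡n (ℕP.≤-pred j≤k)))) (ℤP.*-comm (f (k ∸ j)) (g j)))

⊗-linear : ∀ (f L : Poly) → IsLinear L → ∀ k → (f ⊗ L) k ≡ f k * L 0 + shift f k * L 1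
⊗-linear f L hL zero =
  trans (ℤP.+-identityˡ (f 0 * L 0))
        (sym (trans (cong (λ z → f 0 * L 0 + z) (ℤP.*-zeroˡ (L 1))) (ℤP.+-identityʳ (f 0 * L 0))))
⊗-linear f L hL (suc k) = begin
    (Σ< k (λ j → f j * L (suc k ∸ j)) + f k * L (suc k ∸ k)) + f (suc k) * L (k ∸ k)
  ≡⟨ cong₂ (λ a b → (a + f k * L b) + f (suc k) * L (k ∸ k)) high-terms (suc∸self k) ⟩
    (+ 0 + f k * L 1) + f (suc k) * L (k ∸ k)
  ≡⟨ cong (λ z → (+ 0 + f k * L 1) + f (suc k) * L z) (ℕP.n∸n≡0 k) ⟩
    (+ 0 + f k * L 1) + f (suc k) * L 0
  ≡⟨ cong (_+ f (suc k) * L 0) (ℤP.+-identityˡ (f k * L 1)) ⟩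
    f k * L 1 + f (suc k) * L 0
  ≡⟨ ℤP.+-comm (f k * L 1) (f (suc k) * L 0) ⟩
    f (suc k) * L 0 + f k * L 1
  ∎
  where
  suc∸self : ∀ k → suc k ∸ k ≡ 1
  suc∸self zero    = refl
  suc∸self (suc k) = suc∸self k

  far-index : ∀ j k → j < k → suc k ∸ j ≡ suc (suc (k ∸ suc j))
  far-index zero    (suc k) _           = refl
  far-index (suc j) (suc k) (ℕ.s≤s j<k) = far-index j k j<k

  high-terms : Σ< k (λ j → f j * L (suc k ∸ j)) ≡ + 0
  high-terms = Σ-zero k _ (λ j j<k →
    trans (cong (λ z → f j * L z) (far-index j k j<k)) (trans (cong (f j *_) (hL _)) (ℤP.*-zeroʳ (f j))))

⊗-shift : ∀ (f P : Poly) k → Σ< (suc k) (λ j → f j * shift P (k ∸ j)) ≡ shift (f ⊗ P) k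
⊗-shift f P zero    = trans (ℤP.+-identityˡ _) (ℤP.*-zeroʳ (f 0))
⊗-shift f P (suc k) =
  trans (cong₂ _+_ (Σ-cong (suc k) (λ j j≤k → cong (λ z → f j * shift P z) (ℕP.+-∸-assoc 1 (ℕP.≤-pred j≤k))))
                   (trans (cong (λ z → f (suc k) * shift P z) (ℕP.n∸n≡0 k)) (ℤP.*-zeroʳ (f (suc k)))))
        (ℤP.+-identityʳ _)

⊗-assoc-linear : ∀ (f P L : Poly) → IsLinear L → ∀ k → (f ⊗ (P ⊗ L)) k ≡ ((f ⊗ P) ⊗ L) k
⊗-assoc-linear f P L hL k = begin
    Σ< (suc k) (λ j → f j * (P ⊗ L) (k ∸ j))
  ≡⟨ Σ-cong′ (suc k) (λ j → trans (cong (f j *_) (⊗-linear P L hL (k ∸ j))) (distrib (f j) _ _ _ _)) ⟩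
    Σ< (suc k) (λ j → f j * P (k ∸ j) * L 0 + f j * shift P (k ∸ j) * L 1)
  ≡⟨ Σ-+ (suc k) _ _ ⟩
    Σ< (suc k) (λ j → f j * P (k ∸ j) * L 0) + Σ< (suc k) (λ j → f j * shift P (k ∸ j) * L 1)
  ≡⟨ cong₂ _+_ (Σ-*ʳ (suc k) (L 0) _) (Σ-*ʳ (suc k) (L 1) _) ⟩
    (f ⊗ P) k * L 0 + Σ< (suc k) (λ j → f j * shift P (k ∸ j)) * L 1
  ≡⟨ cong (λ z → (f ⊗ P) k * L 0 + z * L 1) (⊗-shift f P k) ⟩
    (f ⊗ P) k * L 0 + shift (f ⊗ P) k * L 1
  ≡⟨ sym (⊗-linear (f ⊗ P) L hL k) ⟩
    ((f ⊗ P) ⊗ L) k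
  ∎
  where
  distrib : ∀ (a b c d e : ℤ) → a * (b * c + d * e) ≡ a * b * c + a * d * e
  distrib = ℤ-Solver.solve-∀

one-⊗ : ∀ (g : Poly) k → (const (+ 1) ⊗ g) k ≡ g k
one-⊗ g k = trans (⊗-comm (const (+ 1)) g k) (trans (⊗-linear g (const (+ 1)) (λ _ → refl) k)
  (trans (cong₂ _+_ (ℤP.*-identityʳ (g k)) (ℤP.*-zeroʳ (shift g k))) (ℤP.+-identityʳ (g k))))

-- The backward difference  Δ f (k) = f k - f (k-1),  i.e. multiplication by 1 - x

Δ : Poly → Poly
Δ f k = f k - shift f k

Δ^ : ℕ → Poly → Poly
Δ^ zero    f = f
Δ^ (suc e) f = Δ (Δ^ e f)

shift-cong : ∀ {f g : Poly} → (∀ i → f i ≡ g i) → ∀ k → shift f k ≡ shift g k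
shift-cong h zero    = refl
shift-cong h (suc k) = h k

Δ-cong : ∀ {f g : Poly} → (∀ i → f i ≡ g i) → ∀ k → Δ f k ≡ Δ g k
Δ-cong h k = cong₂ _-_ (h k) (shift-cong h k)

Δ^-cong : ∀ e {f g : Poly} → (∀ i → f i ≡ g i) → ∀ k → Δ^ e f k ≡ Δ^ e g k
Δ^-cong zero    h = h
Δ^-cong (suc e) h = Δ-cong (Δ^-cong e h)

Δ^-Σ : ∀ e n (a : ℕ → ℤ) (g : ℕ → Poly) k →
       Δ^ e (λ i → Σ< n (λ q → a q * g q i)) k ≡ Σ< n (λ q → a q * Δ^ e (g q) k)
Δ^-Σ zero    n a g k = refl
Δ^-Σ (suc e) n a g k = trans (Δ-cong (Δ^-Σ e n a g) k) (Δ-Σ (λ q → Δ^ e (g q)) k)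
  where
  shift-Σ : ∀ (h : ℕ → Poly) k → shift (λ i → Σ< n (λ q → a q * h q i)) k ≡ Σ< n (λ q → a q * shift (h q) k)
  shift-Σ h zero    = sym (Σ-zero n _ (λ q _ → ℤP.*-zeroʳ (a q)))
  shift-Σ h (suc k) = refl

  Δ-Σ : ∀ (h : ℕ → Poly) k → Δ (λ i → Σ< n (λ q → a q * h q i)) k ≡ Σ< n (λ q → a q * Δ (h q) k)
  Δ-Σ h k = trans (cong (Σ< n (λ q → a q * h q k) -_) (shift-Σ h k))
    (trans (sym (Σ-- n _ _)) (Σ-cong′ n (λ q → sym (*-distribˡ-- (a q) _ _))))
    where
    *-distribˡ-- : ∀ (c x y : ℤ) → c * (x - y) ≡ c * x - c * y
    *-distribˡ-- = ℤ-Solver.solve-∀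

Δ^-+ : ∀ a c f k → Δ^ (a ℕ.+ c) f k ≡ Δ^ a (Δ^ c f) k
Δ^-+ zero    c f k = refl
Δ^-+ (suc a) c f k = Δ-cong (Δ^-+ a c f) k

Δ^-suc : ∀ e f k → Δ^ (suc e) f k ≡ Δ^ e (Δ f) k
Δ^-suc e f k = trans (cong (λ z → Δ^ z f k) (ℕP.+-comm 1 e)) (Δ^-+ e 1 f k)

oneMinusX : Poly
oneMinusX = const (+ 1) ⊖ X

onePlusX : Poly
onePlusX = const (+ 1) ⊕ X

oneMinusX-pow-⊗ : ∀ e (g : Poly) k → (pow oneMinusX e ⊗ g) k ≡ Δ^ e g k
oneMinusX-pow-⊗ zero    g k = one-⊗ g k
oneMinusX-pow-⊗ (suc e) g k = begin
    ((pow oneMinusX e ⊗ oneMinusX) ⊗ g) k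
  ≡⟨ ⊗-comm (pow oneMinusX e ⊗ oneMinusX) g k ⟩
    (g ⊗ (pow oneMinusX e ⊗ oneMinusX)) k
  ≡⟨ ⊗-assoc-linear g (pow oneMinusX e) oneMinusX (λ _ → refl) k ⟩
    ((g ⊗ pow oneMinusX e) ⊗ oneMinusX) k
  ≡⟨ ⊗-linear (g ⊗ pow oneMinusX e) oneMinusX (λ _ → refl) k ⟩
    (g ⊗ pow oneMinusX e) k * + 1 + shift (g ⊗ pow oneMinusX e) k * -[1+ 0 ]
  ≡⟨ as-difference ((g ⊗ pow oneMinusX e) k) (shift (g ⊗ pow oneMinusX e) k) ⟩
    Δ (g ⊗ pow oneMinusX e) k
  ≡⟨ Δ-cong (λ i → trans (⊗-comm g (pow oneMinusX e) i) (oneMinusX-pow-⊗ e g i)) k ⟩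
    Δ^ (suc e) g k
  ∎
  where
  as-difference : ∀ (x y : ℤ) → x * + 1 + y * -[1+ 0 ] ≡ x - y
  as-difference = ℤ-Solver.solve-∀

mono-diag : ∀ r → mono r r ≡ + 1
mono-diag zero    = refl
mono-diag (suc r) = mono-diag r

mono-off : ∀ r q → q ≢ r → mono r q ≡ + 0
mono-off zero    zero    ne = ⊥-elim (ne refl)
mono-off zero    (suc q) ne = refl
mono-off (suc r) zero    ne = refl
mono-off (suc r) (suc q) ne = mono-off r q (λ e → ne (cong suc e))

⊗-mono-below : ∀ (f : Poly) p q → q < p → (f ⊗ mono p) q ≡ + 0
⊗-mono-below f p q q<p = trans (⊗-comm f (mono p) q)
  (Σ-zero (suc q) _ (λ s s≤q → trans (cong (_* f (q ∸ s)) (mono-off p s (λ e → ℕP.<-irrefl e (ℕP.≤-<-trans (ℕP.≤-pred s≤q) q<p))))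
                                     (ℤP.*-zeroˡ (f (q ∸ s)))))

⊗-mono-above : ∀ (f : Poly) p j → (f ⊗ mono p) (p ℕ.+ j) ≡ f j
⊗-mono-above f p j = trans (⊗-comm f (mono p) (p ℕ.+ j))
  (trans (Σ-single (suc (p ℕ.+ j)) p _ (ℕ.s≤s (ℕP.m≤m+n p j))
           (λ s _ s≢p → trans (cong (_* f (p ℕ.+ j ∸ s)) (mono-off p s s≢p)) (ℤP.*-zeroˡ (f (p ℕ.+ j ∸ s)))))
  (trans (cong₂ _*_ (mono-diag p) (cong f (ℕP.m+n∸m≡n p j))) (ℤP.*-identityˡ (f j))))

-- Binomial sequences and their differences

-- binomSeq q b = xᵠ · Σ_i C(i+b, b) xⁱ = xᵠ / (1-x)^{b+1}.
binomSeq : ℕ → ℕ → Poly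
binomSeq zero    b i       = + ((i ℕ.+ b) C b)
binomSeq (suc q) b zero    = + 0
binomSeq (suc q) b (suc i) = binomSeq q b i

binomSeq-suc : ∀ q b i → binomSeq (suc q) b i ≡ shift (binomSeq q b) i
binomSeq-suc q b zero    = refl
binomSeq-suc q b (suc i) = refl

-- Pascal's rule:  Δ (x^q/(1-x)^{b+2}) = x^q/(1-x)^{b+1}.
Δ-binomSeq : ∀ q b i → Δ (binomSeq q (suc b)) i ≡ binomSeq q b i
Δ-binomSeq zero b zero =
  trans (ℤP.+-identityʳ _) (cong +_ (trans (nCn≡1 (suc b)) (sym (nCn≡1 b))))
Δ-binomSeq zero b (suc i) =
  trans (cong (λ z → + z - + ((i ℕ.+ suc b) C suc b)) (sym (nCk+nC[k+1]≡[n+1]C[k+1] (i ℕ.+ suc b) b)))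
    (trans (add-sub (+ ((i ℕ.+ suc b) C b)) (+ ((i ℕ.+ suc b) C suc b)))
           (cong (λ z → + (z C b)) (ℕP.+-suc i b)))
  where
  add-sub : ∀ (x y : ℤ) → (x + y) - y ≡ x
  add-sub = ℤ-Solver.solve-∀
Δ-binomSeq (suc q) b zero    = refl
Δ-binomSeq (suc q) b (suc i) =
  trans (cong (binomSeq q (suc b) i -_) (binomSeq-suc q (suc b) i)) (Δ-binomSeq q b i)

Δ-binomSeq-zero : ∀ q i → Δ (binomSeq q 0) i ≡ mono q i
Δ-binomSeq-zero zero    zero    = refl
Δ-binomSeq-zero zero    (suc i) = refl
Δ-binomSeq-zero (suc q) zero    = refl
Δ-binomSeq-zero (suc q) (suc i) =
  trans (cong (binomSeq q 0 i -_) (binomSeq-suc q 0 i)) (Δ-binomSeq-zero q i)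

mono-as-difference : ∀ b q k → Δ^ (suc b) (binomSeq q b) k ≡ mono q k
mono-as-difference zero    q k = Δ-binomSeq-zero q k
mono-as-difference (suc b) q k =
  trans (Δ^-suc (suc b) (binomSeq q (suc b)) k)
    (trans (Δ^-cong (suc b) (Δ-binomSeq q b) k) (mono-as-difference b q k))

binomSeq-closed : ∀ q c i → binomSeq q (c ℕ.+ q) i ≡ + ((i ℕ.+ c) C (c ℕ.+ q))
binomSeq-closed zero    c i = cong (λ z → + ((i ℕ.+ z) C (c ℕ.+ 0))) (ℕP.+-identityʳ c)
binomSeq-closed (suc q) c zero = sym (cong +_ (k>n⇒nCk≡0 (ℕP.m<m+n c {suc q} (ℕ.s≤s ℕ.z≤n))))
binomSeq-closed (suc q) c (suc i) = trans (cong (λ z → binomSeq q z i) (ℕP.+-suc c q))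
  (trans (binomSeq-closed q (suc c) i) (cong₂ (λ a b → + (a C b)) (ℕP.+-suc i c) (sym (ℕP.+-suc c q))))

onePlusX-pow : ∀ r j → pow onePlusX r j ≡ + (r C j)
onePlusX-pow zero    zero    = refl
onePlusX-pow zero    (suc j) = refl
onePlusX-pow (suc r) j = trans (⊗-linear (pow onePlusX r) onePlusX (λ _ → refl) j) (pascal j)
  where
  pascal : ∀ j → pow onePlusX r j * + 1 + shift (pow onePlusX r) j * + 1 ≡ + (suc r C j)
  pascal zero rewrite onePlusX-pow r 0 = refl
  pascal (suc j) rewrite onePlusX-pow r (suc j) | onePlusX-pow r j =
    trans (cong₂ _+_ (ℤP.*-identityʳ (+ (r C suc j))) (ℤP.*-identityʳ (+ (r C j))))
      (trans (ℤP.+-comm (+ (r C suc j)) (+ (r C j))) (cong +_ (nCk+nC[k+1]≡[n+1]C[k+1] r j)))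

-- Evaluating products of linear polynomials

-- eval N f x = Σ_{q<N} f_q xᵠ, the value of f if deg f < N.
eval : ℕ → Poly → ℤ → ℤ
eval N f x = Σ< N (λ q → f q * x ^ q)

eval-cong : ∀ N {f g : Poly} → (∀ i → f i ≡ g i) → ∀ x → eval N f x ≡ eval N g x
eval-cong N h x = Σ-cong′ N (λ q → cong (_* x ^ q) (h q))

Π< : ℕ → (ℕ → ℤ) → ℤ
Π< zero    f = + 1
Π< (suc n) f = Π< n f * f n

Π<-cong : ∀ n {f g : ℕ → ℤ} → (∀ i → f i ≡ g i) → Π< n f ≡ Π< n g
Π<-cong zero    h = refl
Π<-cong (suc n) h = cong₂ _*_ (Π<-cong n h) (h n)

DegreeBelow : ℕ → Poly → Set
DegreeBelow N f = ∀ q → N ≤ q → f q ≡ + 0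

degree-⊗-linear : ∀ N (f L : Poly) → DegreeBelow N f → IsLinear L → DegreeBelow (suc N) (f ⊗ L)
degree-⊗-linear N f L hf hL (suc q) (ℕ.s≤s N≤q) =
  trans (⊗-linear f L hL (suc q))
        (cong₂ (λ a b → a * L 0 + b * L 1) (hf (suc q) (ℕP.m≤n⇒m≤1+n N≤q)) (hf q N≤q))

eval-⊗-linear : ∀ N (f L : Poly) → DegreeBelow N f → IsLinear L → ∀ x →
                eval (suc N) (f ⊗ L) x ≡ eval N f x * (L 0 + L 1 * x)
eval-⊗-linear N f L hf hL x = begin
    Σ< (suc N) (λ q → (f ⊗ L) q * x ^ q)
  ≡⟨ Σ-cong′ (suc N) (λ q → trans (cong (_* x ^ q) (⊗-linear f L hL q)) (expand (f q) (L 0) (shift f q) (L 1) (x ^ q))) ⟩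
    Σ< (suc N) (λ q → (f q * x ^ q) * L 0 + (shift f q * x ^ q) * L 1)
  ≡⟨ Σ-+ (suc N) _ _ ⟩
    Σ< (suc N) (λ q → (f q * x ^ q) * L 0) + Σ< (suc N) (λ q → (shift f q * x ^ q) * L 1)
  ≡⟨ cong₂ _+_ (Σ-*ʳ (suc N) (L 0) _) (Σ-*ʳ (suc N) (L 1) _) ⟩
    Σ< (suc N) (λ q → f q * x ^ q) * L 0 + Σ< (suc N) (λ q → shift f q * x ^ q) * L 1
  ≡⟨ cong₂ (λ a b → a * L 0 + b * L 1) eval-f eval-shift ⟩
    eval N f x * L 0 + (eval N f x * x) * L 1
  ≡⟨ collect (eval N f x) (L 0) (L 1) x ⟩
    eval N f x * (L 0 + L 1 * x)
  ∎
  where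
  expand : ∀ (a l0 b l1 y : ℤ) → (a * l0 + b * l1) * y ≡ (a * y) * l0 + (b * y) * l1
  expand = ℤ-Solver.solve-∀
  collect : ∀ (e l0 l1 y : ℤ) → e * l0 + (e * y) * l1 ≡ e * (l0 + l1 * y)
  collect = ℤ-Solver.solve-∀
  rearrange : ∀ (a y z : ℤ) → a * (y * z) ≡ (a * z) * y
  rearrange = ℤ-Solver.solve-∀

  eval-f : Σ< (suc N) (λ q → f q * x ^ q) ≡ eval N f x
  eval-f = trans (cong (λ z → eval N f x + z * x ^ N) (hf N ℕP.≤-refl))
             (trans (cong (λ z → eval N f x + z) (ℤP.*-zeroˡ (x ^ N))) (ℤP.+-identityʳ (eval N f x)))
  eval-shift : Σ< (suc N) (λ q → shift f q * x ^ q) ≡ eval N f x * x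
  eval-shift = trans (Σ-shift N _) (trans (ℤP.+-identityˡ _)
                 (trans (Σ-cong′ N (λ q → rearrange (f q) x (x ^ q))) (Σ-*ʳ N x _)))

prod-degree : ∀ k (φ : ℕ → Poly) → (∀ i → IsLinear (φ i)) → DegreeBelow (suc k) (prod k φ)
prod-degree zero    φ hφ (suc q) _ = refl
prod-degree (suc k) φ hφ = degree-⊗-linear (suc k) (prod k φ) (φ k) (prod-degree k φ hφ) (hφ k)

eval-prod : ∀ k (φ : ℕ → Poly) → (∀ i → IsLinear (φ i)) → ∀ x →
            eval (suc k) (prod k φ) x ≡ Π< k (λ i → φ i 0 + φ i 1 * x)
eval-prod zero    φ hφ x = refl
eval-prod (suc k) φ hφ x = trans (eval-⊗-linear (suc k) (prod k φ) (φ k) (prod-degree k φ hφ) (hφ k) x)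
  (cong (_* (φ k 0 + φ k 1 * x)) (eval-prod k φ hφ x))

eval-⊗-prod : ∀ N (f : Poly) → DegreeBelow N f → ∀ r (ψ : ℕ → Poly) → (∀ i → IsLinear (ψ i)) → ∀ x →
              DegreeBelow (r ℕ.+ N) (f ⊗ prod r ψ)
              × (eval (r ℕ.+ N) (f ⊗ prod r ψ) x ≡ eval N f x * Π< r (λ i → ψ i 0 + ψ i 1 * x))
eval-⊗-prod N f hf zero ψ hψ x =
  (λ q N≤q → trans (⊗-one q) (hf q N≤q)) , trans (eval-cong N ⊗-one x) (sym (ℤP.*-identityʳ (eval N f x)))
  where
  ⊗-one : ∀ q → (f ⊗ const (+ 1)) q ≡ f q
  ⊗-one q = trans (⊗-comm f (const (+ 1)) q) (one-⊗ f q)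
eval-⊗-prod N f hf (suc r) ψ hψ x =
  (λ q le → trans (assoc q) (degree-⊗-linear (r ℕ.+ N) g (ψ r) (proj₁ IH) (hψ r) q le)) ,
  trans (eval-cong (suc r ℕ.+ N) assoc x)
    (trans (eval-⊗-linear (r ℕ.+ N) g (ψ r) (proj₁ IH) (hψ r) x)
      (trans (cong (_* (ψ r 0 + ψ r 1 * x)) (proj₂ IH))
             (ℤP.*-assoc (eval N f x) (Π< r (λ i → ψ i 0 + ψ i 1 * x)) (ψ r 0 + ψ r 1 * x))))
  where
  g = f ⊗ prod r ψ
  IH = eval-⊗-prod N f hf r ψ hψ x
  assoc : ∀ q → (f ⊗ prod (suc r) ψ) q ≡ (g ⊗ ψ r) q
  assoc q = ⊗-assoc-linear f (prod r ψ) (ψ r) (hψ r) q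

-- Falling factorials on ℕ:  fall x a = x (x-1) ⋯ (x-a+1)

fall : ℕ → ℕ → ℕ
fall x zero    = 1
fall x (suc a) = x ℕ.* fall (ℕ.pred x) a

pred-∸ : ∀ x a → ℕ.pred x ∸ a ≡ x ∸ suc a
pred-∸ zero    a = ℕP.0∸n≡0 a
pred-∸ (suc x) a = refl

fall-last : ∀ x a → fall x (suc a) ≡ fall x a ℕ.* (x ∸ a)
fall-last x zero = trans (ℕP.*-identityʳ x) (sym (ℕP.+-identityʳ x))
fall-last x (suc a) rewrite fall-last (ℕ.pred x) a | pred-∸ x a =
  sym (ℕP.*-assoc x (fall (ℕ.pred x) a) (x ∸ suc a))

fall-vanishes : ∀ x a → x < a → fall x a ≡ 0
fall-vanishes zero    (suc a) _           = refl
fall-vanishes (suc x) (suc a) (ℕ.s≤s x<a) rewrite fall-vanishes x a x<a = ℕP.*-zeroʳ x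

-- (x+1)·(x)ₐ = (a+1)·(x)ₐ + (x)ₐ₊₁, the recursion behind (x)ₐ = a!·C(x,a).
fall-step : ∀ x a → suc x ℕ.* fall x a ≡ suc a ℕ.* fall x a ℕ.+ fall x (suc a)
fall-step x a with a ≤? x
... | yes a≤x rewrite fall-last x a =
  trans (cong (λ z → suc z ℕ.* fall x a) (sym (ℕP.m+[n∸m]≡n a≤x))) (expand a (x ∸ a) (fall x a))
  where
  expand : ∀ a d F → (suc a ℕ.+ d) ℕ.* F ≡ suc a ℕ.* F ℕ.+ F ℕ.* d
  expand = ℕ-Solver.solve-∀
... | no a≰x rewrite fall-vanishes x a (ℕP.≰⇒> a≰x) | fall-vanishes x (suc a) (ℕP.m<n⇒m<1+n (ℕP.≰⇒> a≰x)) =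
  trans (ℕP.*-zeroʳ (suc x)) (sym (trans (ℕP.+-identityʳ (suc a ℕ.* 0)) (ℕP.*-zeroʳ (suc a))))

fall≡!*C : ∀ x a → fall x a ≡ a ! ℕ.* (x C a)
fall≡!*C x       zero    = refl
fall≡!*C zero    (suc a) = sym (ℕP.*-zeroʳ (suc a !))
fall≡!*C (suc x) (suc a) =
  trans (fall-step x a) (trans (cong₂ (λ u v → suc a ℕ.* u ℕ.+ v) (fall≡!*C x a) (fall≡!*C x (suc a)))
    (trans (regroup (suc a) (a !) (x C a) (x C suc a)) (cong ((suc a !) ℕ.*_) (nCk+nC[k+1]≡[n+1]C[k+1] x a))))
  where
  regroup : ∀ a F c₁ c₂ → a ℕ.* (F ℕ.* c₁) ℕ.+ (a ℕ.* F) ℕ.* c₂ ≡ (a ℕ.* F) ℕ.* (c₁ ℕ.+ c₂)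
  regroup = ℕ-Solver.solve-∀

fall-+ : ∀ x a b → fall x (a ℕ.+ b) ≡ fall x a ℕ.* fall (x ∸ a) b
fall-+ x zero    b = sym (ℕP.+-identityʳ (fall x b))
fall-+ x (suc a) b rewrite fall-+ (ℕ.pred x) a b | pred-∸ x a =
  sym (ℕP.*-assoc x (fall (ℕ.pred x) a) (fall (x ∸ suc a) b))

!-split : ∀ a b → (a ℕ.+ b) ! ≡ fall (a ℕ.+ b) a ℕ.* b !
!-split zero    b = sym (ℕP.+-identityʳ (b !))
!-split (suc a) b rewrite !-split a b = sym (ℕP.*-assoc (suc (a ℕ.+ b)) (fall (a ℕ.+ b) a) (b !))

C̃-eigenvalue : ∀ n q → _/_ ((n ℕ.+ q ℕ.+ 1) !) ((q ℕ.+ 1) !) {{(q ℕ.+ 1) !≢0}} ≡ fall (n ℕ.+ (q ℕ.+ 1)) n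
C̃-eigenvalue n q = trans (cong (λ z → _/_ (z !) ((q ℕ.+ 1) !) {{(q ℕ.+ 1) !≢0}}) (ℕP.+-assoc n q 1))
  (trans (cong (λ z → _/_ z ((q ℕ.+ 1) !) {{(q ℕ.+ 1) !≢0}}) (!-split n (q ℕ.+ 1)))
         (m*n/n≡m (fall (n ℕ.+ (q ℕ.+ 1)) n) ((q ℕ.+ 1) !) {{(q ℕ.+ 1) !≢0}}))

-- Subset-of-a-subset identity:  (n+Q)ₙ·C(m+n, n+Q) = n!·C(m+n, n)·C(m, Q).
fall-C-trinomial : ∀ n Q m → fall (n ℕ.+ Q) n ℕ.* ((m ℕ.+ n) C (n ℕ.+ Q)) ≡ n ! ℕ.* ((m ℕ.+ n) C n) ℕ.* (m C Q)
fall-C-trinomial n Q m = ℕP.*-cancelʳ-≡ _ _ (Q !) {{Q !≢0}} (begin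
    fall (n ℕ.+ Q) n ℕ.* ((m ℕ.+ n) C (n ℕ.+ Q)) ℕ.* Q !
  ≡⟨ swap₃ (fall (n ℕ.+ Q) n) (Q !) ((m ℕ.+ n) C (n ℕ.+ Q)) ⟩
    (fall (n ℕ.+ Q) n ℕ.* Q !) ℕ.* ((m ℕ.+ n) C (n ℕ.+ Q))
  ≡⟨ cong (ℕ._* ((m ℕ.+ n) C (n ℕ.+ Q))) (sym (!-split n Q)) ⟩
    (n ℕ.+ Q) ! ℕ.* ((m ℕ.+ n) C (n ℕ.+ Q))
  ≡⟨ sym (fall≡!*C (m ℕ.+ n) (n ℕ.+ Q)) ⟩
    fall (m ℕ.+ n) (n ℕ.+ Q)
  ≡⟨ fall-+ (m ℕ.+ n) n Q ⟩
    fall (m ℕ.+ n) n ℕ.* fall (m ℕ.+ n ∸ n) Q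
  ≡⟨ cong₂ ℕ._*_ (fall≡!*C (m ℕ.+ n) n) (trans (cong (λ z → fall z Q) (ℕP.m+n∸n≡m m n)) (fall≡!*C m Q)) ⟩
    (n ! ℕ.* ((m ℕ.+ n) C n)) ℕ.* (Q ! ℕ.* (m C Q))
  ≡⟨ regroup (n !) ((m ℕ.+ n) C n) (Q !) (m C Q) ⟩
    n ! ℕ.* ((m ℕ.+ n) C n) ℕ.* (m C Q) ℕ.* Q !
  ∎)
  where
  swap₃ : ∀ F Qf c → (F ℕ.* c) ℕ.* Qf ≡ (F ℕ.* Qf) ℕ.* c
  swap₃ = ℕ-Solver.solve-∀
  regroup : ∀ a b c d → (a ℕ.* b) ℕ.* (c ℕ.* d) ≡ (a ℕ.* b ℕ.* d) ℕ.* c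
  regroup = ℕ-Solver.solve-∀

vandermonde : ∀ r s m → Σ< (suc r) (λ j → + ((r C j) ℕ.* (m C (s ℕ.+ j)))) ≡ + ((m ℕ.+ r) C (s ℕ.+ r))
vandermonde zero s m =
  trans (ℤP.+-identityˡ _)
        (cong +_ (trans (ℕP.*-identityˡ (m C (s ℕ.+ 0))) (cong (_C (s ℕ.+ 0)) (sym (ℕP.+-identityʳ m)))))
vandermonde (suc r) s m = begin
    Σ< (suc (suc r)) h
  ≡⟨ Σ-shift (suc r) h ⟩
    h 0 + Σ< (suc r) (λ j → h (suc j))
  ≡⟨ cong (λ z → h 0 + z) (trans (Σ-cong′ (suc r) pascal) (Σ-+ (suc r) g₁ g₂)) ⟩
    h 0 + (Σ< (suc r) g₁ + Σ< (suc r) g₂)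
  ≡⟨ exchange (h 0) (Σ< (suc r) g₁) (Σ< (suc r) g₂) ⟩
    Σ< (suc r) g₁ + (h 0 + Σ< (suc r) g₂)
  ≡⟨ cong₂ _+_ (vandermonde r (suc s) m) (sym (Σ-shift (suc r) g₀)) ⟩
    + ((m ℕ.+ r) C (suc s ℕ.+ r)) + Σ< (suc (suc r)) g₀
  ≡⟨ cong (λ z → + ((m ℕ.+ r) C (suc s ℕ.+ r)) + (Σ< (suc r) g₀ + z)) g₀-last ⟩
    + ((m ℕ.+ r) C (suc s ℕ.+ r)) + (Σ< (suc r) g₀ + + 0)
  ≡⟨ cong (λ z → + ((m ℕ.+ r) C (suc s ℕ.+ r)) + z) (trans (ℤP.+-identityʳ _) (vandermonde r s m)) ⟩
    + ((m ℕ.+ r) C (suc s ℕ.+ r)) + + ((m ℕ.+ r) C (s ℕ.+ r))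
  ≡⟨ cong +_ (trans (ℕP.+-comm ((m ℕ.+ r) C (suc s ℕ.+ r)) _) (nCk+nC[k+1]≡[n+1]C[k+1] (m ℕ.+ r) (s ℕ.+ r))) ⟩
    + (suc (m ℕ.+ r) C suc (s ℕ.+ r))
  ≡⟨ cong₂ (λ a b → + (a C b)) (sym (ℕP.+-suc m r)) (sym (ℕP.+-suc s r)) ⟩
    + ((m ℕ.+ suc r) C (s ℕ.+ suc r))
  ∎
  where
  h g₀ g₁ g₂ : ℕ → ℤ
  h  j = + ((suc r C j) ℕ.* (m C (s ℕ.+ j)))
  g₀ j = + ((r C j) ℕ.* (m C (s ℕ.+ j)))
  g₁ j = + ((r C j) ℕ.* (m C (suc s ℕ.+ j)))
  g₂ j = + ((r C suc j) ℕ.* (m C (s ℕ.+ suc j)))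

  exchange : ∀ (a b c : ℤ) → a + (b + c) ≡ b + (a + c)
  exchange = ℤ-Solver.solve-∀

  pascal : ∀ j → h (suc j) ≡ g₁ j + g₂ j
  pascal j = trans (cong (λ z → + (z ℕ.* (m C (s ℕ.+ suc j)))) (sym (nCk+nC[k+1]≡[n+1]C[k+1] r j)))
    (trans (cong +_ (ℕP.*-distribʳ-+ (m C (s ℕ.+ suc j)) (r C j) (r C suc j)))
           (cong (λ z → + ((r C j) ℕ.* (m C z)) + g₂ j) (ℕP.+-suc s j)))

  g₀-last : g₀ (suc r) ≡ + 0
  g₀-last = cong (λ z → + (z ℕ.* (m C (s ℕ.+ suc r)))) (k>n⇒nCk≡0 (ℕP.n<1+n r))

-- The left side:  moments of Ũₙ⁻¹ xᵖ
--
-- Throughout, n = r + p + 1 (so r = n - p - 1) and m = i + 1.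

pos-^ : ∀ a b → + (a ℕ.^ b) ≡ (+ a) ^ b
pos-^ a zero    = refl
pos-^ a (suc b) = trans (ℤP.pos-* a (a ℕ.^ b)) (cong (+ a *_) (pos-^ a b))

-- The series of F̃ₙ xᵠ before multiplication by (1-x)^{2n+1}:  i ↦ (i+1)^{q+1} C(i+1+n, n).
moments : ℕ → ℕ → Poly
moments n q i = + (suc i ℕ.^ suc q ℕ.* ((suc i ℕ.+ n) C n))

-- The common sequence whose (2n+1)-st difference both sides turn out to be.
Φ : ℕ → ℕ → Poly
Φ n r i = + (n ! ℕ.* ((r ℕ.+ suc i) C n) ℕ.* ((suc i ℕ.+ n) C n))

Uinv : ℕ → ℕ → Poly
Uinv p r = falling (X ⊖ const (+ 1)) p ⊗ rising (X ⊕ const (+ 1)) r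

-- At x = m the factors give  Πᵢ<ₚ (m-1-i) = (m-1)ₚ  and  Πᵢ<ᵣ (m+1+i) = (m+r)ᵣ.
Uinv-value : ∀ p r i → eval (r ℕ.+ suc p) (Uinv p r) (+ suc i) ≡ + fall i p * + fall (r ℕ.+ suc i) r
Uinv-value p r i =
  trans (proj₂ (eval-⊗-prod (suc p) (prod p factorˡ) (prod-degree p factorˡ (λ _ _ → refl)) r factorʳ (λ _ _ → refl) (+ suc i)))
        (cong₂ _*_ (trans (eval-prod p factorˡ (λ _ _ → refl) (+ suc i)) (trans (Π<-cong p value-left) (falling-product i p)))
                   (trans (Π<-cong r value-right) (rising-product (suc i) r)))
  where
  factorˡ factorʳ : ℕ → Poly
  factorˡ j = X ⊖ const (+ 1) ⊖ const (+ j)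
  factorʳ j = X ⊕ const (+ 1) ⊕ const (+ j)

  value-left : ∀ j → factorˡ j 0 + factorˡ j 1 * + suc i ≡ + i - + j
  value-left j = evaluate (+ i) (+ j)
    where
    evaluate : ∀ (T J : ℤ) → ((+ 0 - + 1) - J) + + 1 * (+ 1 + T) ≡ T - J
    evaluate = ℤ-Solver.solve-∀

  value-right : ∀ j → factorʳ j 0 + factorʳ j 1 * + suc i ≡ + (suc j ℕ.+ suc i)
  value-right j = cong (λ z → + suc j + z) (ℤP.*-identityˡ (+ suc i))

  falling-product : ∀ t p → Π< p (λ j → + t - + j) ≡ + fall t p
  falling-product t zero = refl
  falling-product t (suc p) rewrite falling-product t p | fall-last t p with p ≤? t
  ... | yes p≤t = trans (cong (+ fall t p *_) (trans (ℤP.m-n≡m⊖n t p) (ℤP.⊖-≥ p≤t)))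
                        (sym (ℤP.pos-* (fall t p) (t ∸ p)))
  ... | no p≰t rewrite fall-vanishes t p (ℕP.≰⇒> p≰t) = refl

  rising-product : ∀ m r → Π< r (λ j → + (suc j ℕ.+ m)) ≡ + fall (r ℕ.+ m) r
  rising-product m zero = refl
  rising-product m (suc r) rewrite rising-product m r =
    trans (sym (ℤP.pos-* (fall (r ℕ.+ m) r) (suc (r ℕ.+ m))))
          (cong +_ (ℕP.*-comm (fall (r ℕ.+ m) r) (suc (r ℕ.+ m))))

-- Σ_q (Ũₙ⁻¹xᵖ)_q m^{q+1} C(m+n, n) = m·(m-1)ₚ(m+r)ᵣ·C(m+n, n) = Φ.
Uinv-moment : ∀ p r i → Σ< (r ℕ.+ suc p) (λ q → Uinv p r q * moments (r ℕ.+ suc p) q i) ≡ Φ (r ℕ.+ suc p) r i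
Uinv-moment p r i = begin
    Σ< n (λ q → Uinv p r q * + (m ℕ.^ suc q ℕ.* Cn))
  ≡⟨ Σ-cong′ n (λ q → trans (cong (Uinv p r q *_) (trans (ℤP.pos-* (m ℕ.^ suc q) Cn)
                              (cong (_* + Cn) (trans (ℤP.pos-* m (m ℕ.^ q)) (cong (+ m *_) (pos-^ m q))))))
                      (regroupℤ (Uinv p r q) (+ m) ((+ m) ^ q) (+ Cn))) ⟩
    Σ< n (λ q → (Uinv p r q * (+ m) ^ q) * (+ m * + Cn))
  ≡⟨ Σ-*ʳ n (+ m * + Cn) _ ⟩
    eval n (Uinv p r) (+ m) * (+ m * + Cn)
  ≡⟨ cong (_* (+ m * + Cn)) (Uinv-value p r i) ⟩
    (+ fall i p * + fall (r ℕ.+ m) r) * (+ m * + Cn)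
  ≡⟨ trans (cong₂ _*_ (sym (ℤP.pos-* (fall i p) (fall (r ℕ.+ m) r))) (sym (ℤP.pos-* m Cn)))
           (sym (ℤP.pos-* (fall i p ℕ.* fall (r ℕ.+ m) r) (m ℕ.* Cn))) ⟩
    + ((fall i p ℕ.* fall (r ℕ.+ m) r) ℕ.* (m ℕ.* Cn))
  ≡⟨ cong +_ (trans (regroupℕ (fall i p) (fall (r ℕ.+ m) r) m Cn) (cong (ℕ._* Cn) falls-combine)) ⟩
    + (n ! ℕ.* ((r ℕ.+ m) C n) ℕ.* Cn)
  ∎
  where
  n = r ℕ.+ suc p
  m = suc i
  Cn = (m ℕ.+ n) C n

  regroupℤ : ∀ (u a b c : ℤ) → u * ((a * b) * c) ≡ (u * b) * (a * c)
  regroupℤ = ℤ-Solver.solve-∀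
  regroupℕ : ∀ a b c d → (a ℕ.* b) ℕ.* (c ℕ.* d) ≡ (b ℕ.* (c ℕ.* a)) ℕ.* d
  regroupℕ = ℕ-Solver.solve-∀

  -- (m+r)ᵣ · m(m-1)ₚ = (m+r)ₙ = n!·C(m+r, n)
  falls-combine : fall (r ℕ.+ m) r ℕ.* (m ℕ.* fall i p) ≡ n ! ℕ.* ((r ℕ.+ m) C n)
  falls-combine = trans (cong (λ z → fall (r ℕ.+ m) r ℕ.* fall z (suc p)) (sym (ℕP.m+n∸m≡n r m)))
                    (trans (sym (fall-+ (r ℕ.+ m) r (suc p))) (fall≡!*C (r ℕ.+ m) n))

-- The right side:  C̃ₙ Ṽₙ xᵖ against binomial sequences

C̃-eig : ℕ → ℕ → ℕ
C̃-eig n q = _/_ ((n ℕ.+ q ℕ.+ 1) !) ((q ℕ.+ 1) !) {{(q ℕ.+ 1) !≢0}}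

-- Coefficient of xᵠ in C̃ₙ Ṽₙ xᵖ = C̃ₙ ((1+x)ʳ xᵖ).
CV-coeff : ℕ → ℕ → ℕ → ℕ → ℤ
CV-coeff n p r q = (pow onePlusX r ⊗ mono p) q * + C̃-eig n q

compose-CV : ∀ n p q → q < n → compose n (Ct n) (Vt n) p q ≡ CV-coeff n p (n ∸ p ∸ 1) q
compose-CV n p q q<n =
  trans (Σ-single n q _ q<n (λ s _ s≢q → trans (cong (λ z → Vt n p s * (+ C̃-eig n s * z)) (mono-off s q (λ e → s≢q (sym e))))
                                              (trans (cong (Vt n p s *_) (ℤP.*-zeroʳ (+ C̃-eig n s))) (ℤP.*-zeroʳ (Vt n p s)))))
        (cong (Vt n p q *_) (trans (cong (+ C̃-eig n q *_) (mono-diag q)) (ℤP.*-identityʳ (+ C̃-eig n q))))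

-- Σ_q (C̃ₙṼₙxᵖ)_q · C(m+n, n+q+1)
--   = Σ_j C(r, j)·(n+p+j+1)ₙ·C(m+n, n+p+j+1)      (q = p + j)
--   = n!·C(m+n, n)·Σ_j C(r, j)·C(m, p+1+j)
--   = n!·C(m+n, n)·C(m+r, n)                       (Vandermonde).
CV-moment : ∀ p r i → let n = r ℕ.+ suc p in
            Σ< n (λ q → CV-coeff n p r q * binomSeq q (n ℕ.+ suc q) i) ≡ Φ n r i
CV-moment p r i = begin
    Σ< n (λ q → A q * binomSeq q (n ℕ.+ suc q) i)
  ≡⟨ Σ-cong′ n (λ q → cong (A q *_) (trans (cong (λ z → binomSeq q z i) (ℕP.+-suc n q)) (binomSeq-closed q (suc n) i))) ⟩
    Σ< n (λ q → A q * + ((i ℕ.+ suc n) C (suc n ℕ.+ q)))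
  ≡⟨ cong (λ z → Σ< z (λ q → A q * + ((i ℕ.+ suc n) C (suc n ℕ.+ q)))) n≡p+suc-r ⟩
    Σ< (p ℕ.+ suc r) (λ q → A q * + ((i ℕ.+ suc n) C (suc n ℕ.+ q)))
  ≡⟨ Σ-split p (suc r) _ ⟩
    Σ< p (λ q → A q * + ((i ℕ.+ suc n) C (suc n ℕ.+ q)))
      + Σ< (suc r) (λ j → A (p ℕ.+ j) * + ((i ℕ.+ suc n) C (suc n ℕ.+ (p ℕ.+ j))))
  ≡⟨ cong₂ _+_ (Σ-zero p _ (λ q q<p → cong (λ z → z * + C̃-eig n q * + ((i ℕ.+ suc n) C (suc n ℕ.+ q)))
                                            (⊗-mono-below (pow onePlusX r) p q q<p)))
               (Σ-cong′ (suc r) term) ⟩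
    + 0 + Σ< (suc r) (λ j → + (n ! ℕ.* Cn) * + ((r C j) ℕ.* (m C (suc p ℕ.+ j))))
  ≡⟨ ℤP.+-identityˡ _ ⟩
    Σ< (suc r) (λ j → + (n ! ℕ.* Cn) * + ((r C j) ℕ.* (m C (suc p ℕ.+ j))))
  ≡⟨ Σ-*ˡ (suc r) (+ (n ! ℕ.* Cn)) _ ⟩
    + (n ! ℕ.* Cn) * Σ< (suc r) (λ j → + ((r C j) ℕ.* (m C (suc p ℕ.+ j))))
  ≡⟨ cong (+ (n ! ℕ.* Cn) *_) (vandermonde r (suc p) m) ⟩
    + (n ! ℕ.* Cn) * + ((m ℕ.+ r) C (suc p ℕ.+ r))
  ≡⟨ sym (ℤP.pos-* (n ! ℕ.* Cn) _) ⟩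
    + (n ! ℕ.* Cn ℕ.* ((m ℕ.+ r) C (suc p ℕ.+ r)))
  ≡⟨ cong (λ z → + (n ! ℕ.* Cn ℕ.* z)) (cong₂ _C_ (ℕP.+-comm m r) (ℕP.+-comm (suc p) r)) ⟩
    + (n ! ℕ.* Cn ℕ.* ((r ℕ.+ m) C n))
  ≡⟨ cong +_ (swap₂ (n !) Cn ((r ℕ.+ m) C n)) ⟩
    Φ n r i
  ∎
  where
  n = r ℕ.+ suc p
  m = suc i
  Cn = (m ℕ.+ n) C n
  A = CV-coeff n p r

  swap₂ : ∀ a b c → (a ℕ.* b) ℕ.* c ≡ a ℕ.* c ℕ.* b
  swap₂ = ℕ-Solver.solve-∀
  regroup : ∀ a x y z → a ℕ.* (x ℕ.* y ℕ.* z) ≡ (x ℕ.* y) ℕ.* (a ℕ.* z)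
  regroup = ℕ-Solver.solve-∀

  n≡p+suc-r : n ≡ p ℕ.+ suc r
  n≡p+suc-r = trans (ℕP.+-suc r p) (trans (cong suc (ℕP.+-comm r p)) (sym (ℕP.+-suc p r)))

  term : ∀ j → A (p ℕ.+ j) * + ((i ℕ.+ suc n) C (suc n ℕ.+ (p ℕ.+ j)))
               ≡ + (n ! ℕ.* Cn) * + ((r C j) ℕ.* (m C (suc p ℕ.+ j)))
  term j = begin
      ((pow onePlusX r ⊗ mono p) (p ℕ.+ j) * + C̃-eig n (p ℕ.+ j)) * + ((i ℕ.+ suc n) C (suc n ℕ.+ (p ℕ.+ j)))
    ≡⟨ cong₂ (λ a b → (a * + b) * + ((i ℕ.+ suc n) C (suc n ℕ.+ (p ℕ.+ j))))
             (trans (⊗-mono-above (pow onePlusX r) p j) (onePlusX-pow r j)) (C̃-eigenvalue n (p ℕ.+ j)) ⟩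
      (+ (r C j) * + F) * + ((i ℕ.+ suc n) C (suc n ℕ.+ (p ℕ.+ j)))
    ≡⟨ trans (cong (_* + B) (sym (ℤP.pos-* (r C j) F))) (sym (ℤP.pos-* ((r C j) ℕ.* F) B)) ⟩
      + ((r C j) ℕ.* F ℕ.* ((i ℕ.+ suc n) C (suc n ℕ.+ (p ℕ.+ j))))
    ≡⟨ cong (λ z → + ((r C j) ℕ.* F ℕ.* z)) (cong₂ _C_ (ℕP.+-suc i n) n+Q) ⟩
      + ((r C j) ℕ.* F ℕ.* ((m ℕ.+ n) C (n ℕ.+ Q)))
    ≡⟨ cong +_ (trans (ℕP.*-assoc (r C j) F _) (cong ((r C j) ℕ.*_) (fall-C-trinomial n Q m))) ⟩
      + ((r C j) ℕ.* (n ! ℕ.* Cn ℕ.* (m C Q)))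
    ≡⟨ cong +_ (regroup (r C j) (n !) Cn (m C Q)) ⟩
      + ((n ! ℕ.* Cn) ℕ.* ((r C j) ℕ.* (m C Q)))
    ≡⟨ ℤP.pos-* (n ! ℕ.* Cn) _ ⟩
      + (n ! ℕ.* Cn) * + ((r C j) ℕ.* (m C Q))
    ≡⟨ cong (λ z → + (n ! ℕ.* Cn) * + ((r C j) ℕ.* (m C z))) (ℕP.+-comm (p ℕ.+ j) 1) ⟩
      + (n ! ℕ.* Cn) * + ((r C j) ℕ.* (m C (suc p ℕ.+ j)))
    ∎
    where
    Q = p ℕ.+ j ℕ.+ 1
    F = fall (n ℕ.+ Q) n
    B = (i ℕ.+ suc n) C (suc n ℕ.+ (p ℕ.+ j))
    n+Q : suc n ℕ.+ (p ℕ.+ j) ≡ n ℕ.+ Q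
    n+Q = trans (sym (ℕP.+-suc n (p ℕ.+ j))) (cong (n ℕ.+_) (ℕP.+-comm 1 (p ℕ.+ j)))

-- Both sides as (2n+1)-st differences of Φ

Ft-as-difference : ∀ n q k → Ft n q k ≡ Δ^ (suc (2 ℕ.* n)) (moments n q) k
Ft-as-difference n q k = oneMinusX-pow-⊗ (suc (2 ℕ.* n)) (moments n q) k

-- Ṽₙ⁻¹ xᵠ = (1-x)^{n-q-1} xᵠ = Δ^{n-q-1} Δ^{n+q+2} binomSeq = Δ^{2n+1} binomSeq.
Vt-inv-as-difference : ∀ n q k → q < n → Vt-inv n q k ≡ Δ^ (suc (2 ℕ.* n)) (binomSeq q (n ℕ.+ suc q)) k
Vt-inv-as-difference n q k q<n = begin
    (pow oneMinusX d ⊗ mono q) k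
  ≡⟨ oneMinusX-pow-⊗ d (mono q) k ⟩
    Δ^ d (mono q) k
  ≡⟨ Δ^-cong d (λ i → sym (mono-as-difference (n ℕ.+ suc q) q i)) k ⟩
    Δ^ d (Δ^ (suc (n ℕ.+ suc q)) (binomSeq q (n ℕ.+ suc q))) k
  ≡⟨ sym (Δ^-+ d (suc (n ℕ.+ suc q)) _ k) ⟩
    Δ^ (d ℕ.+ suc (n ℕ.+ suc q)) (binomSeq q (n ℕ.+ suc q)) k
  ≡⟨ cong (λ e → Δ^ e (binomSeq q (n ℕ.+ suc q)) k) exponent ⟩
    Δ^ (suc (2 ℕ.* n)) (binomSeq q (n ℕ.+ suc q)) k
  ∎
  where
  d = n ∸ q ∸ 1

  d+q+1≡n : d ℕ.+ suc q ≡ n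
  d+q+1≡n = trans (cong (ℕ._+ suc q) (ℕP.∸-+-assoc n q 1)) (trans (cong (λ z → n ∸ z ℕ.+ suc q) (ℕP.+-comm q 1))
                  (ℕP.m∸n+n≡m q<n))

  exponent : d ℕ.+ suc (n ℕ.+ suc q) ≡ suc (2 ℕ.* n)
  exponent = trans (regroup d n q) (cong (λ z → suc (n ℕ.+ z)) (trans d+q+1≡n (sym (ℕP.*-identityˡ n))))
    where
    regroup : ∀ d n q → d ℕ.+ suc (n ℕ.+ suc q) ≡ suc (n ℕ.+ (d ℕ.+ suc q))
    regroup = ℕ-Solver.solve-∀

exponent-r : ∀ p r → r ℕ.+ suc p ∸ p ∸ 1 ≡ r
exponent-r p r = cong (_∸ 1) (trans (cong (_∸ p) (ℕP.+-suc r p)) (ℕP.m+n∸n≡m (suc r) p))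

left-side : ∀ p r k → let n = r ℕ.+ suc p in
            compose n (Ft n) (Ut-inv n) p k ≡ Δ^ (suc (2 ℕ.* n)) (Φ n r) k
left-side p r k = begin
    Σ< n (λ q → Ut-inv n p q * Ft n q k)
  ≡⟨ Σ-cong′ n (λ q → cong₂ _*_ (cong (λ z → Uinv p z q) (exponent-r p r)) (Ft-as-difference n q k)) ⟩
    Σ< n (λ q → Uinv p r q * Δ^ N (moments n q) k)
  ≡⟨ sym (Δ^-Σ N n (Uinv p r) (moments n) k) ⟩
    Δ^ N (λ i → Σ< n (λ q → Uinv p r q * moments n q i)) k
  ≡⟨ Δ^-cong N (Uinv-moment p r) k ⟩
    Δ^ N (Φ n r) k
  ∎
  where
  n = r ℕ.+ suc p
  N = suc (2 ℕ.* n)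

right-side : ∀ p r k → let n = r ℕ.+ suc p in
             compose n (Vt-inv n) (compose n (Ct n) (Vt n)) p k ≡ Δ^ (suc (2 ℕ.* n)) (Φ n r) k
right-side p r k = begin
    Σ< n (λ q → compose n (Ct n) (Vt n) p q * Vt-inv n q k)
  ≡⟨ Σ-cong n (λ q q<n → cong₂ _*_ (trans (compose-CV n p q q<n) (cong (λ z → CV-coeff n p z q) (exponent-r p r)))
                                   (Vt-inv-as-difference n q k q<n)) ⟩
    Σ< n (λ q → CV-coeff n p r q * Δ^ N (binomSeq q (n ℕ.+ suc q)) k)
  ≡⟨ sym (Δ^-Σ N n (CV-coeff n p r) (λ q → binomSeq q (n ℕ.+ suc q)) k) ⟩
    Δ^ N (λ i → Σ< n (λ q → CV-coeff n p r q * binomSeq q (n ℕ.+ suc q) i)) k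
  ≡⟨ Δ^-cong N (CV-moment p r) k ⟩
    Δ^ N (Φ n r) k
  ∎
  where
  n = r ℕ.+ suc p
  N = suc (2 ℕ.* n)

theorem7 : (n : ℕ) → 1 ≤ n → (p : ℕ) → p < n → (k : ℕ) →
           compose n (Ft n) (Ut-inv n) p k
             ≡ compose n (Vt-inv n) (compose n (Ct n) (Vt n)) p k
theorem7 n _ p p<n k =
  subst (λ n′ → compose n′ (Ft n′) (Ut-inv n′) p k ≡ compose n′ (Vt-inv n′) (compose n′ (Ct n′) (Vt n′)) p k)
        (ℕP.m∸n+n≡m p<n)
        (trans (left-side p r k) (sym (right-side p r k)))
  where
  r = n ∸ suc p
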